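{- Capture-avoiding substitution respects differential equivalence: for all unrestricted $\lambda_\epsilon$-terms $s,s',t,t'$ and every variable $x$, if $s\sim_\epsilon s'$ and $t\sim_\epsilon t'$, then $t[s/x]\sim_\epsilon t'[s'/x]$.
   Context: Unrestricted terms of the $\lambda_\epsilon$-calculus are generated by the grammar $t ::= x \mid \lambda x.t \mid (s\ t) \mid \mathsf{D}(s)\cdot t \mid \epsilon t \mid s+t \mid 0$, over a countably infinite set of variables; $\lambda$ is the only binder and terms are considered up to $\alpha$-equivalence. Capture-avoiding substitution $t[s/x]$ is defined as usual: $x[s/x]=s$, $y[s/x]=y$ for $y\neq x$, $(\lambda y.t)[s/x]=\lambda y.(t[s/x])$ (with $y\ne x$, $y$ not free in $s$), and it commutes with all other constructors: $(t\ e)[s/x]=(t[s/x])\ (e[s/x])$, $(\mathsf{D}(t)\cdot e)[s/x]=\mathsf{D}(t[s/x])\cdot(e[s/x])$, $(\epsilon t)[s/x]=\epsilon(t[s/x])$, $(t+e)[s/x]=t[s/x]+e[s/x]$, $0[s/x]=0$. A binary relation $\sim$ on terms is contextual if $t\sim t'$ implies $\lambda x.t\sim\lambda x.t'$ and $\epsilon t\sim\epsilon t'$, and $s\sim s'$, $t\sim t'$ imply $(s\ t)\sim(s'\ t')$, $\mathsf{D}(s)\cdot t\sim\mathsf{D}(s')\cdot t'$ and $s+t\sim s'+t'$. We write $\epsilon^k t$ for $k$-fold application of $\epsilon$. Differential equivalence $\sim_\epsilon$ is the least contextual equivalence relation containing the following pairs (for all terms $s,t,e$ and variables $x$): $(s+t)+e\sim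 s+(t+e)$; $s+0\sim s$; $s+t\sim t+s$; $\epsilon 0\sim 0$; $\epsilon(s+t)\sim\epsilon s+\epsilon t$; $\lambda x.0\sim 0$; $\lambda x.(s+t)\sim(\lambda x.s)+(\lambda x.t)$; $\lambda x.\epsilon t\sim\epsilon(\lambda x.t)$; $(0\ s)\sim 0$; $((s+t)\ e)\sim(s\ e)+(t\ e)$; $((\epsilon s)\ t)\sim\epsilon(s\ t)$; $\mathsf{D}(0)\cdot e\sim 0$; $\mathsf{D}(s+t)\cdot e\sim(\mathsf{D}(s)\cdot e)+(\mathsf{D}(t)\cdot e)$; $\mathsf{D}(\epsilon t)\cdot e\sim\epsilon(\mathsf{D}(t)\cdot e)$; $\mathsf{D}(s)\cdot 0\sim 0$; $\mathsf{D}(s)\cdot(t+e)\sim\mathsf{D}(s)\cdot t+\mathsf{D}(s)\cdot e+\epsilon(\mathsf{D}(\mathsf{D}(s)\cdot t)\cdot e)$; $\mathsf{D}(s)\cdot(\epsilon t)\sim\epsilon(\mathsf{D}(s)\cdot t)$; $\mathsf{D}(\mathsf{D}(s)\cdot t)\cdot e\sim\mathsf{D}(\mathsf{D}(s)\cdot e)\cdot t$; $\epsilon^2(\mathsf{D}(\mathsf{D}(s)\cdot t)\cdot e)\sim\epsilon(\mathsf{D}(\mathsf{D}(s)\cdot t)\cdot e)$; $(s\ (t+\epsilon e))\sim(s\ t)+\epsilon((\mathsf{D}(s)\cdot e)\ t)$. -}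

module Defs where

open import Data.Nat using (ℕ; zero; suc; _<ᵇ_; _≡ᵇ_)
open import Data.Bool using (if_then_else_)

-- Unrestricted λε-terms, with variables as de Bruijn indices
-- (so terms are identified up to α-equivalence by construction).
data Term : Set where
  var  : ℕ → Term
  lam  : Term → Term              -- λx.t  (binds index 0)
  app  : Term → Term → Term
  dif  : Term → Term → Term       -- D(s)·t
  eps  : Term → Term
  _⊕_  : Term → Term → Term
  𝟎    : Term

infixl 6 _⊕_

shift : ℕ → Term → Term
shift c (var y)   = if y <ᵇ c then var y else var (suc y)
shift c (lam t)   = lam (shift (suc c) t)
shift c (app s t) = app (shift c s) (shift c t)
shift c (dif s t) = dif (shift c s) (shift c t)
shift c (eps t)   = eps (shift c t)
shift c (s ⊕ t)   = shift c s ⊕ shift c t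
shift c 𝟎         = 𝟎

_[_/_] : Term → Term → ℕ → Term
var y   [ s / x ] = if y ≡ᵇ x then s else var y
lam t   [ s / x ] = lam (t [ shift 0 s / suc x ])
app t e [ s / x ] = app (t [ s / x ]) (e [ s / x ])
dif t e [ s / x ] = dif (t [ s / x ]) (e [ s / x ])
eps t   [ s / x ] = eps (t [ s / x ])
(t ⊕ e) [ s / x ] = (t [ s / x ]) ⊕ (e [ s / x ])
𝟎       [ s / x ] = 𝟎

infix 4 _∼ε_
data _∼ε_ : Term → Term → Set where
  ∼refl  : ∀ {t} → t ∼ε t
  ∼sym   : ∀ {s t} → s ∼ε t → t ∼ε s
  ∼trans : ∀ {s t e} → s ∼ε t → t ∼ε e → s ∼ε e
  ∼lam : ∀ {t t'} → t ∼ε t' → lam t ∼ε lam t'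
  ∼eps : ∀ {t t'} → t ∼ε t' → eps t ∼ε eps t'
  ∼app : ∀ {s s' t t'} → s ∼ε s' → t ∼ε t' → app s t ∼ε app s' t'
  ∼dif : ∀ {s s' t t'} → s ∼ε s' → t ∼ε t' → dif s t ∼ε dif s' t'
  ∼sum : ∀ {s s' t t'} → s ∼ε s' → t ∼ε t' → s ⊕ t ∼ε s' ⊕ t'
  ax-assoc    : ∀ {s t e} → (s ⊕ t) ⊕ e ∼ε s ⊕ (t ⊕ e)
  ax-unit     : ∀ {s} → s ⊕ 𝟎 ∼ε s
  ax-comm     : ∀ {s t} → s ⊕ t ∼ε t ⊕ s
  ax-eps0     : eps 𝟎 ∼ε 𝟎
  ax-eps+     : ∀ {s t} → eps (s ⊕ t) ∼ε eps s ⊕ eps t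
  ax-lam0     : lam 𝟎 ∼ε 𝟎
  ax-lam+     : ∀ {s t} → lam (s ⊕ t) ∼ε lam s ⊕ lam t
  ax-lamε     : ∀ {t} → lam (eps t) ∼ε eps (lam t)
  ax-app0     : ∀ {s} → app 𝟎 s ∼ε 𝟎
  ax-app+     : ∀ {s t e} → app (s ⊕ t) e ∼ε app s e ⊕ app t e
  ax-appε     : ∀ {s t} → app (eps s) t ∼ε eps (app s t)
  ax-D0       : ∀ {e} → dif 𝟎 e ∼ε 𝟎
  ax-D+       : ∀ {s t e} → dif (s ⊕ t) e ∼ε dif s e ⊕ dif t e
  ax-Dε       : ∀ {t e} → dif (eps t) e ∼ε eps (dif t e)
  ax-D·0      : ∀ {s} → dif s 𝟎 ∼ε 𝟎
  ax-D·+      : ∀ {s t e} →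
                dif s (t ⊕ e) ∼ε dif s t ⊕ dif s e ⊕ eps (dif (dif s t) e)
  ax-D·ε      : ∀ {s t} → dif s (eps t) ∼ε eps (dif s t)
  ax-DDswap   : ∀ {s t e} → dif (dif s t) e ∼ε dif (dif s e) t
  ax-ε²DD     : ∀ {s t e} → eps (eps (dif (dif s t) e)) ∼ε eps (dif (dif s t) e)
  ax-app+ε    : ∀ {s t e} → app s (t ⊕ eps e) ∼ε app s t ⊕ eps (app (dif s e) t)

module Submission where

open import Defs
open import Data.Nat using (ℕ; suc; _≡ᵇ_)
open import Data.Bool using (true; false)
open import Data.Product using (_×_; _,_)
open import Relation.Binary.PropositionalEquality using (_≡_; refl; sym; cong; cong₂; subst₂)

-- Every axiom of ∼ε is a schema in metavariables that never mentions a
-- variable, so any map that acts on variables only and otherwise commutes with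
-- the constructors sends instances of axioms to instances of the same axiom.
-- Shifting and substitution are such maps, which gives congruence of t [ s / x ]
-- in t; congruence in s is then a plain induction on t.

module Traversal {I : Set} (under : I → I) (onVar : I → ℕ → Term) where

  traverse : I → Term → Term
  traverse i (var y)   = onVar i y
  traverse i (lam t)   = lam (traverse (under i) t)
  traverse i (app s t) = app (traverse i s) (traverse i t)
  traverse i (dif s t) = dif (traverse i s) (traverse i t)
  traverse i (eps t)   = eps (traverse i t)
  traverse i (s ⊕ t)   = traverse i s ⊕ traverse i t
  traverse i 𝟎         = 𝟎

  traverse-resp : ∀ i {t t'} → t ∼ε t' → traverse i t ∼ε traverse i t'
  traverse-resp i ∼refl        = ∼refl
  traverse-resp i (∼sym p)     = ∼sym (traverse-resp i p)
  traverse-resp i (∼trans p q) = ∼trans (traverse-resp i p) (traverse-resp i q)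
  traverse-resp i (∼lam p)     = ∼lam (traverse-resp (under i) p)
  traverse-resp i (∼eps p)     = ∼eps (traverse-resp i p)
  traverse-resp i (∼app p q)   = ∼app (traverse-resp i p) (traverse-resp i q)
  traverse-resp i (∼dif p q)   = ∼dif (traverse-resp i p) (traverse-resp i q)
  traverse-resp i (∼sum p q)   = ∼sum (traverse-resp i p) (traverse-resp i q)
  traverse-resp i ax-assoc     = ax-assoc
  traverse-resp i ax-unit      = ax-unit
  traverse-resp i ax-comm      = ax-comm
  traverse-resp i ax-eps0      = ax-eps0
  traverse-resp i ax-eps+      = ax-eps+
  traverse-resp i ax-lam0      = ax-lam0
  traverse-resp i ax-lam+      = ax-lam+
  traverse-resp i ax-lamε      = ax-lamε
  traverse-resp i ax-app0      = ax-app0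
  traverse-resp i ax-app+      = ax-app+
  traverse-resp i ax-appε      = ax-appε
  traverse-resp i ax-D0        = ax-D0
  traverse-resp i ax-D+        = ax-D+
  traverse-resp i ax-Dε        = ax-Dε
  traverse-resp i ax-D·0       = ax-D·0
  traverse-resp i ax-D·+       = ax-D·+
  traverse-resp i ax-D·ε       = ax-D·ε
  traverse-resp i ax-DDswap    = ax-DDswap
  traverse-resp i ax-ε²DD      = ax-ε²DD
  traverse-resp i ax-app+ε     = ax-app+ε

  traverse-resp-≡ : ∀ {f : I → Term → Term} → (∀ i t → f i t ≡ traverse i t) →
                    ∀ i {t t'} → t ∼ε t' → f i t ∼ε f i t'
  traverse-resp-≡ {f} f≡ i {t} {t'} p =
    subst₂ _∼ε_ (sym (f≡ i t)) (sym (f≡ i t')) (traverse-resp i p)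

open Traversal using (traverse; traverse-resp-≡)

shift-as-traverse : ∀ c t → shift c t ≡ traverse suc (λ c y → shift c (var y)) c t
shift-as-traverse c (var y)   = refl
shift-as-traverse c (lam t)   = cong lam (shift-as-traverse (suc c) t)
shift-as-traverse c (app s t) = cong₂ app (shift-as-traverse c s) (shift-as-traverse c t)
shift-as-traverse c (dif s t) = cong₂ dif (shift-as-traverse c s) (shift-as-traverse c t)
shift-as-traverse c (eps t)   = cong eps (shift-as-traverse c t)
shift-as-traverse c (s ⊕ t)   = cong₂ _⊕_ (shift-as-traverse c s) (shift-as-traverse c t)
shift-as-traverse c 𝟎         = refl

shift-resp : ∀ c {s s'} → s ∼ε s' → shift c s ∼ε shift c s'
shift-resp = traverse-resp-≡ suc (λ c y → shift c (var y)) shift-as-traverse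

substUnder : Term × ℕ → Term × ℕ
substUnder (s , x) = shift 0 s , suc x

substVar : Term × ℕ → ℕ → Term
substVar (s , x) y = var y [ s / x ]

subst-as-traverse : ∀ s x t → t [ s / x ] ≡ traverse substUnder substVar (s , x) t
subst-as-traverse s x (var y)   = refl
subst-as-traverse s x (lam t)   = cong lam (subst-as-traverse (shift 0 s) (suc x) t)
subst-as-traverse s x (app a b) = cong₂ app (subst-as-traverse s x a) (subst-as-traverse s x b)
subst-as-traverse s x (dif a b) = cong₂ dif (subst-as-traverse s x a) (subst-as-traverse s x b)
subst-as-traverse s x (eps a)   = cong eps (subst-as-traverse s x a)
subst-as-traverse s x (a ⊕ b)   = cong₂ _⊕_ (subst-as-traverse s x a) (subst-as-traverse s x b)
subst-as-traverse s x 𝟎         = refl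

subst-respˡ : ∀ (s : Term) (x : ℕ) {t t'} → t ∼ε t' → (t [ s / x ]) ∼ε (t' [ s / x ])
subst-respˡ s x =
  traverse-resp-≡ substUnder substVar (λ (s , x) → subst-as-traverse s x) (s , x)

subst-respʳ : ∀ (t : Term) (x : ℕ) {s s'} → s ∼ε s' → (t [ s / x ]) ∼ε (t [ s' / x ])
subst-respʳ (var y) x s∼s' with y ≡ᵇ x
... | true  = s∼s'
... | false = ∼refl
subst-respʳ (lam t)   x s∼s' = ∼lam (subst-respʳ t (suc x) (shift-resp 0 s∼s'))
subst-respʳ (app a b) x s∼s' = ∼app (subst-respʳ a x s∼s') (subst-respʳ b x s∼s')
subst-respʳ (dif a b) x s∼s' = ∼dif (subst-respʳ a x s∼s') (subst-respʳ b x s∼s')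
subst-respʳ (eps a)   x s∼s' = ∼eps (subst-respʳ a x s∼s')
subst-respʳ (a ⊕ b)   x s∼s' = ∼sum (subst-respʳ a x s∼s') (subst-respʳ b x s∼s')
subst-respʳ 𝟎         x s∼s' = ∼refl

mainTheorem2 : ∀ (s s' t t' : Term) (x : ℕ) →
    s ∼ε s' → t ∼ε t' → (t [ s / x ]) ∼ε (t' [ s' / x ])
mainTheorem2 s s' t t' x s∼s' t∼t' =
  ∼trans (subst-respˡ s x t∼t') (subst-respʳ t' x s∼s')
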